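{- Let $s,k$ be positive integers and $\mathbf{a} = (a_1,\ldots,a_k) \in \mathbb{Z}^k$. There is a constant $C$ depending at most on $s$ and $k$ such that for all real $X \ge 1$, \[ J_{s,k}(X;\mathbf{a}) \le C X^{ -1} H_{s,k}(X;\mathbf{a}). \]
   Context: $J_{s,k}(X;\mathbf{a})$ denotes the number of pairs $(\mathbf{x},\mathbf{y})$ with $\mathbf{x}, \mathbf{y} \in \mathbb{Z}^s \cap [-X,X]^s$ satisfying $\sum_{i=1}^s (x_i^j - y_i^j) = a_j$ for all $1 \le j \le k$. Define polynomials $p_j(h) = \sum_{m=1}^{j} \binom{j}{m} a_m h^{j-m}$ for $1 \le j \le k$. $H_{s,k}(X;\mathbf{a})$ denotes the number of triples $(\mathbf{z},\mathbf{w},h)$ with $\mathbf{z},\mathbf{w} \in \mathbb{Z}^s \cap [-2X,2X]^s$ and $h \in \mathbb{Z} \cap [-X,X]$ satisfying $\sum_{i=1}^s (z_i^j - w_i^j) = p_j(h)$ for all $1 \le j \le k$.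
   Formalization: The parameter X ranges over rational numbers $X \ge 1$ instead of real ones. -}

module Defs where

open import Data.Bool using (Bool; true; false; _∧_)
open import Data.Nat as ℕ using (ℕ; zero; suc)
open import Data.Nat.Combinatorics using (_C_)
open import Data.Integer as ℤ using (ℤ; +_; -_)
open import Data.Rational as ℚ using (ℚ)
open import Data.List using (List; []; _∷_; map; concatMap; filter; length; upTo; applyUpTo)
open import Data.Vec as Vec using (Vec; []; _∷_)
open import Data.Product using (_×_; _,_)
open import Relation.Nullary using (does)

rangeℤ : ℕ → List ℤ
rangeℤ B = map (λ i → + i ℤ.- + B) (upTo (suc (2 ℕ.* B)))

box : ℚ → List ℤ
box X = filter (λ n → ℚ.- X ℚ.≤? (n ℚ./ 1) Relation.Nullary.×-dec (n ℚ./ 1) ℚ.≤? X)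
               (rangeℤ (suc ℤ.∣ ℚ.floor X ∣))
  where import Relation.Nullary

vecs : (s : ℕ) → List ℤ → List (Vec ℤ s)
vecs zero    L = [] ∷ []
vecs (suc s) L = concatMap (λ x → map (x ∷_) (vecs s L)) L

count : {A : Set} → (A → Bool) → List A → ℕ
count P []       = 0
count P (x ∷ xs) = if P x then suc (count P xs) else count P xs
  where open import Data.Bool using (if_then_else_)

_==_ : ℤ → ℤ → Bool
x == y = does (x ℤ.≟ y)

sumV : {s : ℕ} → Vec ℤ s → ℤ
sumV = Vec.foldr _ ℤ._+_ (+ 0)

powDiff : {s : ℕ} → ℕ → Vec ℤ s → Vec ℤ s → ℤ
powDiff j x y = sumV (Vec.zipWith (λ u v → u ℤ.^ j ℤ.- v ℤ.^ j) x y)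

-- a_m for 1 ≤ m ≤ k (a : Vec ℤ k stores (a_1,…,a_k)); 0 outside this range (never used)
coeff : {k : ℕ} → Vec ℤ k → ℕ → ℤ
coeff []       _             = + 0
coeff (x ∷ xs) zero          = + 0
coeff (x ∷ xs) (suc zero)    = x
coeff (x ∷ xs) (suc (suc m)) = coeff xs (suc m)

sumTo : ℕ → (ℕ → ℤ) → ℤ
sumTo zero    f = + 0
sumTo (suc n) f = sumTo n f ℤ.+ f (suc n)

pPoly : {k : ℕ} → Vec ℤ k → ℕ → ℤ → ℤ
pPoly a j h = sumTo j (λ m → + (j C m) ℤ.* coeff a m ℤ.* h ℤ.^ (j ℕ.∸ m))

allEq : {s : ℕ} → ℕ → Vec ℤ s → Vec ℤ s → (ℕ → ℤ) → Bool
allEq zero    x y rhs = true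
allEq (suc j) x y rhs = allEq j x y rhs ∧ (powDiff (suc j) x y == rhs (suc j))

J : (s k : ℕ) → ℚ → Vec ℤ k → ℕ
J s k X a = count (λ { (x , y) → allEq k x y (coeff a) })
                  (concatMap (λ x → map (x ,_) (vecs s (box X))) (vecs s (box X)))

H : (s k : ℕ) → ℚ → Vec ℤ k → ℕ
H s k X a = count (λ { ((z , w) , h) → allEq k z w (λ j → pPoly a j h) })
                  (concatMap (λ zw → map (zw ,_) (box X))
                    (concatMap (λ z → map (z ,_) (vecs s (box (2X)))) (vecs s (box (2X)))))
  where 2X = (+ 2 ℚ./ 1) ℚ.* X

{-# OPTIONS --safe #-}
module Submission where

-- The translation (x, y, h) ↦ (x + h·1, y + h·1, h) sends every solution (x, y) counted by J,
-- together with any integer h ∈ [-X, X], to a solution counted by H: by the binomial theorem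
--   Σᵢ (xᵢ + h)ʲ - (yᵢ + h)ʲ = Σ_{1≤m≤j} binom(j, m) (Σᵢ xᵢᵐ - yᵢᵐ) hʲ⁻ᵐ = pⱼ(h),
-- and the coordinates stay in [-2X, 2X]. The map is injective, so J · #(ℤ ∩ [-X, X]) ≤ H,
-- and #(ℤ ∩ [-X, X]) ≥ ⌊X⌋ + 1 ≥ X. Hence the lemma holds with C = 1.

open import Defs
open import Data.Bool using (Bool; true; false; _∧_; if_then_else_)
open import Data.Bool.Properties using (T-≡; ∧-conicalˡ; ∧-conicalʳ)
open import Data.Empty using (⊥-elim)
open import Data.Fin using (toℕ)
open import Data.Integer as ℤ using (ℤ; +_; -[1+_]; 0ℤ; _+_; _*_; _-_; _^_; +≤+)
open import Data.Integer.DivMod using ([n/ℕd]*d≤n; n<s[n/ℕd]*d)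
import Data.Integer.Properties as ℤP
open import Data.Integer.Tactic.RingSolver using (solve-∀)
open import Data.List
  using (List; []; _∷_; _++_; length; map; filter; concatMap; upTo; cartesianProductWith; cartesianProduct)
import Data.List.Properties as LP
open import Data.List.Membership.Propositional using (_∈_)
open import Data.List.Membership.Propositional.Properties
open import Data.List.Relation.Binary.Subset.Propositional using (_⊆_)
open import Data.List.Relation.Unary.All as All using ([])
open import Data.List.Relation.Unary.AllPairs using ([]; _∷_)
open import Data.List.Relation.Unary.Any using (here; there)
open import Data.List.Relation.Unary.Unique.Propositional using (Unique)
import Data.List.Relation.Unary.Unique.Propositional.Properties as Unique
open import Data.Nat as ℕ using (ℕ; zero; suc; _∸_; z≤n; s≤s)
open import Data.Nat.Combinatorics using (_C_)
open import Data.Nat.Coprimality using (1-coprimeTo)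
import Data.Nat.Coprimality as Coprimality
import Data.Nat.Properties as ℕP
open import Data.Product using (Σ; _×_; _,_; proj₁; proj₂)
open import Data.Product.Properties using (,-injectiveˡ; ,-injectiveʳ)
open import Data.Rational as ℚ using (ℚ; mkℚ; ↥_; ↧_; ↧ₙ_; _≤_; *≤*)
import Data.Rational.Properties as ℚP
open import Data.Sum using (inj₁; inj₂)
open import Data.Vec as Vec using (Vec; []; _∷_)
import Data.Vec.Properties as VecP
open import Data.Vec.Relation.Unary.All as VecAll using ([]; _∷_) renaming (All to AllV)
import Data.Vec.Relation.Unary.All.Properties as VecAllP
open import Function using (_∘_; Equivalence)
open import Function.Definitions using (Injective)
open import Relation.Nullary using (Dec; yes; no; _×-dec_)
open import Relation.Nullary.Decidable using (T?; dec-true)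
open import Relation.Binary.PropositionalEquality
  using (_≡_; refl; sym; trans; cong; cong₂; subst; subst₂; module ≡-Reasoning)
open import Algebra.Properties.CommutativeSemigroup ℤP.+-commutativeSemigroup using (interchange)
open import Algebra.Properties.Semiring.Sum ℤP.+-*-semiring using (sum-cong-≗; sum-syntax; sum⁺-syntax)
import Algebra.Properties.Semiring.Mult ℤP.+-*-semiring as Mult
import Algebra.Properties.Semiring.Exp ℤP.+-*-semiring as Exp
import Algebra.Properties.CommutativeSemiring.Binomial ℤP.+-*-commutativeSemiring as Binomial
open import Algebra.Properties.AbelianGroup ℤP.+-0-abelianGroup using () renaming (∙-cancelʳ to +-cancelʳ)
open import Algebra.Properties.AbelianGroup ℚP.+-0-abelianGroup using () renaming (⁻¹-involutive to neg-involutive)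

sumTo-cong : ∀ n {f g : ℕ → ℤ} → (∀ {m} → 1 ℕ.≤ m → m ℕ.≤ n → f m ≡ g m) →
  sumTo n f ≡ sumTo n g
sumTo-cong zero    f≡g = refl
sumTo-cong (suc n) f≡g =
  cong₂ _+_ (sumTo-cong n (λ 1≤m m≤n → f≡g 1≤m (ℕP.m≤n⇒m≤1+n m≤n)))
            (f≡g (s≤s z≤n) ℕP.≤-refl)

sumTo-+ : ∀ n (f g : ℕ → ℤ) → sumTo n (λ m → f m + g m) ≡ sumTo n f + sumTo n g
sumTo-+ zero    f g = refl
sumTo-+ (suc n) f g rewrite sumTo-+ n f g = interchange (sumTo n f) (sumTo n g) (f (suc n)) (g (suc n))

sumTo-- : ∀ n (f g : ℕ → ℤ) → sumTo n (λ m → f m - g m) ≡ sumTo n f - sumTo n g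
sumTo-- zero    f g = refl
sumTo-- (suc n) f g rewrite sumTo-- n f g = regroup (sumTo n f) (sumTo n g) (f (suc n)) (g (suc n))
  where
  regroup : ∀ a b c d → a - b + (c - d) ≡ a + c - (b + d)
  regroup = solve-∀

sumTo-0 : ∀ n → sumTo n (λ _ → 0ℤ) ≡ 0ℤ
sumTo-0 zero    = refl
sumTo-0 (suc n) = cong (_+ 0ℤ) (sumTo-0 n)

sumTo-suc : ∀ n (f : ℕ → ℤ) → sumTo (suc n) f ≡ f 1 + sumTo n (f ∘ suc)
sumTo-suc zero    f = ℤP.+-comm 0ℤ (f 1)
sumTo-suc (suc n) f = trans (cong (_+ f (2 ℕ.+ n)) (sumTo-suc n f)) (ℤP.+-assoc (f 1) _ _)

sumTo≡∑ : ∀ n (f : ℕ → ℤ) → sumTo n f ≡ ∑[ i < n ] f (suc (toℕ i))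
sumTo≡∑ zero    f = refl
sumTo≡∑ (suc n) f = trans (sumTo-suc n f) (cong (λ s → f 1 + s) (sumTo≡∑ n (f ∘ suc)))

×≡* : ∀ n c → n Mult.× c ≡ + n * c
×≡* zero    c = refl
×≡* (suc n) c = trans (cong (λ s → c + s) (×≡* n c)) (sym (ℤP.suc-* (+ n) c))

^≡^ : ∀ c n → c Exp.^ n ≡ c ^ n
^≡^ c zero    = refl
^≡^ c (suc n) = cong (c *_) (^≡^ c n)

binomial : ∀ j u h → (u + h) ^ j ≡ h ^ j + sumTo j (λ m → + (j C m) * u ^ m * h ^ (j ∸ m))
binomial j u h = begin
  (u + h) ^ j                      ≡⟨ sym (^≡^ (u + h) j) ⟩
  (u + h) Exp.^ j                  ≡⟨ Binomial.theorem j u h ⟩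
  Binomial.binomialExpansion u h j ≡⟨ sum-cong-≗ {suc j} (λ k → term (toℕ k)) ⟩
  ∑[ k ≤ j ] T (toℕ k)             ≡⟨ cong₂ _+_ (ℤP.*-identityˡ (h ^ j)) (sym (sumTo≡∑ j T)) ⟩
  h ^ j + sumTo j T                ∎
  where
  open ≡-Reasoning
  T : ℕ → ℤ
  T m = + (j C m) * u ^ m * h ^ (j ∸ m)
  term : ∀ m → (j C m) Mult.× (u Exp.^ m * h Exp.^ (j ∸ m)) ≡ T m
  term m rewrite ×≡* (j C m) (u Exp.^ m * h Exp.^ (j ∸ m)) | ^≡^ u m | ^≡^ h (j ∸ m) =
    sym (ℤP.*-assoc (+ (j C m)) (u ^ m) (h ^ (j ∸ m)))

binomial-difference : ∀ j u v h →
  (u + h) ^ j - (v + h) ^ j ≡ sumTo j (λ m → + (j C m) * (u ^ m - v ^ m) * h ^ (j ∸ m))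
binomial-difference j u v h = begin
  (u + h) ^ j - (v + h) ^ j                   ≡⟨ cong₂ _-_ (binomial j u h) (binomial j v h) ⟩
  (h ^ j + sumTo j (T u)) - (h ^ j + sumTo j (T v)) ≡⟨ cancel (h ^ j) (sumTo j (T u)) (sumTo j (T v)) ⟩
  sumTo j (T u) - sumTo j (T v)              ≡⟨ sym (sumTo-- j (T u) (T v)) ⟩
  sumTo j (λ m → T u m - T v m)
    ≡⟨ sumTo-cong j (λ {m} _ _ → factor (+ (j C m)) (u ^ m) (v ^ m) (h ^ (j ∸ m))) ⟩
  sumTo j (λ m → + (j C m) * (u ^ m - v ^ m) * h ^ (j ∸ m)) ∎
  where
  open ≡-Reasoning
  T : ℤ → ℕ → ℤ
  T w m = + (j C m) * w ^ m * h ^ (j ∸ m)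
  cancel : ∀ a b c → (a + b) - (a + c) ≡ b - c
  cancel = solve-∀
  factor : ∀ c a b z → c * a * z - c * b * z ≡ c * (a - b) * z
  factor = solve-∀

translate : ∀ {s} → ℤ → Vec ℤ s → Vec ℤ s
translate h = Vec.map (_+ h)

powDiff-translate : ∀ {s} j (x y : Vec ℤ s) h →
  powDiff j (translate h x) (translate h y) ≡ sumTo j (λ m → + (j C m) * powDiff m x y * h ^ (j ∸ m))
powDiff-translate j [] [] h = sym (trans (sumTo-cong j (λ {m} _ _ → vanish (+ (j C m)) (h ^ (j ∸ m)))) (sumTo-0 j))
  where
  vanish : ∀ c z → c * 0ℤ * z ≡ 0ℤ
  vanish = solve-∀
powDiff-translate j (u ∷ x) (v ∷ y) h = begin
  ((u + h) ^ j - (v + h) ^ j) + powDiff j (translate h x) (translate h y)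
    ≡⟨ cong₂ _+_ (binomial-difference j u v h) (powDiff-translate j x y h) ⟩
  sumTo j (λ m → + (j C m) * (u ^ m - v ^ m) * h ^ (j ∸ m))
    + sumTo j (λ m → + (j C m) * powDiff m x y * h ^ (j ∸ m))
    ≡⟨ sym (sumTo-+ j _ _) ⟩
  sumTo j (λ m → + (j C m) * (u ^ m - v ^ m) * h ^ (j ∸ m) + + (j C m) * powDiff m x y * h ^ (j ∸ m))
    ≡⟨ sumTo-cong j (λ {m} _ _ → factor (+ (j C m)) (u ^ m - v ^ m) (powDiff m x y) (h ^ (j ∸ m))) ⟩
  sumTo j (λ m → + (j C m) * powDiff m (u ∷ x) (v ∷ y) * h ^ (j ∸ m)) ∎
  where
  open ≡-Reasoning
  factor : ∀ c a b z → c * a * z + c * b * z ≡ c * (a + b) * z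
  factor = solve-∀

==⇒≡ : ∀ {a b} → (a == b) ≡ true → a ≡ b
==⇒≡ {a} {b} eq with a ℤ.≟ b | eq
... | yes a≡b | _ = a≡b
... | no _    | ()

allEq⇒powDiff≡ : ∀ {s} k {x y : Vec ℤ s} {r : ℕ → ℤ} → allEq k x y r ≡ true →
  ∀ {j} → 1 ℕ.≤ j → j ℕ.≤ k → powDiff j x y ≡ r j
allEq⇒powDiff≡ zero    _   (s≤s _) ()
allEq⇒powDiff≡ (suc k) {x} {y} {r} sol 1≤j j≤1+k with ℕP.m≤n⇒m<n∨m≡n j≤1+k
... | inj₁ (s≤s j≤k) = allEq⇒powDiff≡ k (∧-conicalˡ (allEq k x y r) _ sol) 1≤j j≤k
... | inj₂ refl      = ==⇒≡ (∧-conicalʳ (allEq k x y r) _ sol)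

powDiff≡⇒allEq : ∀ {s} k {x y : Vec ℤ s} {r : ℕ → ℤ} →
  (∀ {j} → 1 ℕ.≤ j → j ℕ.≤ k → powDiff j x y ≡ r j) → allEq k x y r ≡ true
powDiff≡⇒allEq zero    _     = refl
powDiff≡⇒allEq (suc k) {x} {y} {r} eqs = cong₂ _∧_
  (powDiff≡⇒allEq k (λ 1≤j j≤k → eqs 1≤j (ℕP.m≤n⇒m≤1+n j≤k)))
  (dec-true (powDiff (suc k) x y ℤ.≟ r (suc k)) (eqs (s≤s z≤n) ℕP.≤-refl))

translate-solution : ∀ {s k} (a : Vec ℤ k) {x y : Vec ℤ s} h → allEq k x y (coeff a) ≡ true →
  allEq k (translate h x) (translate h y) (λ j → pPoly a j h) ≡ true
translate-solution {k = k} a {x} {y} h sol = powDiff≡⇒allEq k λ {j} 1≤j j≤k → begin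
  powDiff j (translate h x) (translate h y)               ≡⟨ powDiff-translate j x y h ⟩
  sumTo j (λ m → + (j C m) * powDiff m x y * h ^ (j ∸ m)) ≡⟨ sumTo-cong j (λ {m} 1≤m m≤j →
    cong (λ c → + (j C m) * c * h ^ (j ∸ m)) (allEq⇒powDiff≡ k sol 1≤m (ℕP.≤-trans m≤j j≤k))) ⟩
  pPoly a j h                                              ∎
  where open ≡-Reasoning

Unique-⊆⇒length≤ : ∀ {A : Set} {xs ys : List A} → Unique xs → xs ⊆ ys → length xs ℕ.≤ length ys
Unique-⊆⇒length≤ {xs = []}     _          _    = z≤n
Unique-⊆⇒length≤ {xs = x ∷ xs} (x∉ ∷ uxs) x∷xs⊆ys with ∈-∃++ (x∷xs⊆ys (here refl))
... | as , bs , refl = begin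
  suc (length xs)          ≤⟨ s≤s (Unique-⊆⇒length≤ uxs xs⊆as++bs) ⟩
  suc (length (as ++ bs))  ≡⟨ cong suc (LP.length-++ as) ⟩
  suc (length as ℕ.+ length bs) ≡⟨ sym (ℕP.+-suc (length as) (length bs)) ⟩
  length as ℕ.+ length (x ∷ bs) ≡⟨ sym (LP.length-++ as) ⟩
  length (as ++ x ∷ bs)    ∎
  where
  open ℕP.≤-Reasoning
  xs⊆as++bs : xs ⊆ as ++ bs
  xs⊆as++bs {z} z∈xs with ∈-++⁻ as (x∷xs⊆ys (there z∈xs))
  ... | inj₁ z∈as         = ∈-++⁺ˡ z∈as
  ... | inj₂ (here refl)  = ⊥-elim (All.lookup x∉ z∈xs refl)
  ... | inj₂ (there z∈bs) = ∈-++⁺ʳ as z∈bs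

count≡length∘filter : ∀ {A : Set} (P : A → Bool) xs → count P xs ≡ length (filter (T? ∘ P) xs)
count≡length∘filter P []       = refl
count≡length∘filter P (x ∷ xs) with P x
... | true  = cong suc (count≡length∘filter P xs)
... | false = count≡length∘filter P xs

injection⇒count≤ : ∀ {A B : Set} {P : A → Bool} {Q : B → Bool} {L : List A} {M : List B} (f : A → B) →
  Injective _≡_ _≡_ f → Unique L →
  (∀ {a} → a ∈ L → P a ≡ true → f a ∈ M × Q (f a) ≡ true) →
  count P L ℕ.≤ count Q M
injection⇒count≤ {P = P} {Q} {L} {M} f f-inj uL f-maps = begin
  count P L                      ≡⟨ count≡length∘filter P L ⟩
  length (filter (T? ∘ P) L)     ≡⟨ sym (LP.length-map f (filter (T? ∘ P) L)) ⟩
  length (map f (filter (T? ∘ P) L))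
    ≤⟨ Unique-⊆⇒length≤ (Unique.map⁺ f-inj (Unique.filter⁺ (T? ∘ P) uL)) image⊆ ⟩
  length (filter (T? ∘ Q) M)     ≡⟨ sym (count≡length∘filter Q M) ⟩
  count Q M                      ∎
  where
  open ℕP.≤-Reasoning
  image⊆ : map f (filter (T? ∘ P) L) ⊆ filter (T? ∘ Q) M
  image⊆ z∈ with ∈-map⁻ f z∈
  ... | a , a∈ , refl with ∈-filter⁻ (T? ∘ P) a∈
  ... | a∈L , Pa with f-maps a∈L (Equivalence.to T-≡ Pa)
  ... | fa∈M , Qfa = ∈-filter⁺ (T? ∘ Q) fa∈M (Equivalence.from T-≡ Qfa)

concatMap-map≡cartesianProductWith : ∀ {A B C : Set} (g : A → B → C) xs ys →
  concatMap (λ x → map (g x) ys) xs ≡ cartesianProductWith g xs ys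
concatMap-map≡cartesianProductWith g []       ys = refl
concatMap-map≡cartesianProductWith g (x ∷ xs) ys =
  cong (map (g x) ys ++_) (concatMap-map≡cartesianProductWith g xs ys)

count-++ : ∀ {A : Set} (P : A → Bool) xs ys → count P (xs ++ ys) ≡ count P xs ℕ.+ count P ys
count-++ P []       ys = refl
count-++ P (x ∷ xs) ys with P x
... | true  = cong suc (count-++ P xs ys)
... | false = count-++ P xs ys

count-map-, : ∀ {A B : Set} (P : A → Bool) x (ys : List B) →
  count (P ∘ proj₁) (map (x ,_) ys) ≡ (if P x then length ys else 0)
count-map-, P x []       with P x
... | true  = refl
... | false = refl
count-map-, P x (y ∷ ys) with P x | count-map-, P x ys
... | true  | ih = cong suc ih
... | false | ih = ih

count-cartesianProduct : ∀ {A B : Set} (P : A → Bool) xs (ys : List B) →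
  count (P ∘ proj₁) (cartesianProduct xs ys) ≡ count P xs ℕ.* length ys
count-cartesianProduct P []       ys = refl
count-cartesianProduct P (x ∷ xs) ys = begin
  count (P ∘ proj₁) (map (x ,_) ys ++ cartesianProduct xs ys)
    ≡⟨ count-++ (P ∘ proj₁) (map (x ,_) ys) (cartesianProduct xs ys) ⟩
  count (P ∘ proj₁) (map (x ,_) ys) ℕ.+ count (P ∘ proj₁) (cartesianProduct xs ys)
    ≡⟨ cong₂ ℕ._+_ (count-map-, P x ys) (count-cartesianProduct P xs ys) ⟩
  (if P x then length ys else 0) ℕ.+ count P xs ℕ.* length ys
    ≡⟨ collect (P x) ⟩
  count P (x ∷ xs) ℕ.* length ys ∎
  where
  open ≡-Reasoning
  collect : ∀ b → (if b then length ys else 0) ℕ.+ count P xs ℕ.* length ys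
                ≡ (if b then suc (count P xs) else count P xs) ℕ.* length ys
  collect true  = refl
  collect false = refl

vecs≡cartesianProductWith : ∀ s (L : List ℤ) → vecs (suc s) L ≡ cartesianProductWith _∷_ L (vecs s L)
vecs≡cartesianProductWith s L = concatMap-map≡cartesianProductWith _∷_ L (vecs s L)

vecs⁺ : ∀ s {L} → Unique L → Unique (vecs s L)
vecs⁺ zero    uL = [] ∷ []
vecs⁺ (suc s) {L} uL = subst Unique (sym (vecs≡cartesianProductWith s L))
  (Unique.cartesianProductWith⁺ _∷_ VecP.∷-injective uL (vecs⁺ s uL))

∈-vecs⁻ : ∀ {s L} {x : Vec ℤ s} → x ∈ vecs s L → AllV (_∈ L) x
∈-vecs⁻ {zero}  {x = []} _ = []
∈-vecs⁻ {suc s} {L} x∈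
  with ∈-cartesianProductWith⁻ _∷_ L (vecs s L) (subst (_ ∈_) (vecs≡cartesianProductWith s L) x∈)
... | _ , _ , u∈L , x∈vecs , refl = u∈L ∷ ∈-vecs⁻ x∈vecs

∈-vecs⁺ : ∀ {s L} {x : Vec ℤ s} → AllV (_∈ L) x → x ∈ vecs s L
∈-vecs⁺ []                        = here refl
∈-vecs⁺ {suc s} {L} (u∈L ∷ x∈Ls) = subst (_ ∈_) (sym (vecs≡cartesianProductWith s L))
  (∈-cartesianProductWith⁺ _∷_ u∈L (∈-vecs⁺ x∈Ls))

translate-∈-vecs : ∀ {s L M} {x : Vec ℤ s} h → (∀ {u} → u ∈ L → u + h ∈ M) →
  x ∈ vecs s L → translate h x ∈ vecs s M
translate-∈-vecs h shift x∈ = ∈-vecs⁺ (VecAllP.map⁺ (VecAll.map shift (∈-vecs⁻ x∈)))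

translate-injective : ∀ {s} h → Injective _≡_ _≡_ (translate {s} h)
translate-injective h {[]}    {[]}    _  = refl
translate-injective h {u ∷ x} {v ∷ y} eq with VecP.∷-injective eq
... | u+h≡v+h , x+h≡y+h = cong₂ _∷_ (+-cancelʳ _ _ _ u+h≡v+h) (translate-injective h x+h≡y+h)

translation-count : ∀ s {B B′ : List ℤ} → Unique B → (∀ {u h} → u ∈ B → h ∈ B → u + h ∈ B′) →
  {P : Vec ℤ s × Vec ℤ s → Bool} {Q : (Vec ℤ s × Vec ℤ s) × ℤ → Bool} →
  (∀ {x y} h → P (x , y) ≡ true → Q ((translate h x , translate h y) , h) ≡ true) →
  count P (cartesianProduct (vecs s B) (vecs s B)) ℕ.* length B
    ℕ.≤ count Q (cartesianProduct (cartesianProduct (vecs s B′) (vecs s B′)) B)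
translation-count s {B} {B′} uB closed {P} {Q} preserves = begin
  count P V² ℕ.* length B                  ≡⟨ sym (count-cartesianProduct P V² B) ⟩
  count (P ∘ proj₁) (cartesianProduct V² B) ≤⟨ injection⇒count≤ τ τ-injective uV²×B τ-maps ⟩
  count Q (cartesianProduct W² B)          ∎
  where
  open ℕP.≤-Reasoning
  V² = cartesianProduct (vecs s B) (vecs s B)
  W² = cartesianProduct (vecs s B′) (vecs s B′)
  τ : (Vec ℤ s × Vec ℤ s) × ℤ → (Vec ℤ s × Vec ℤ s) × ℤ
  τ ((x , y) , h) = (translate h x , translate h y) , h
  τ-injective : Injective _≡_ _≡_ τ
  τ-injective {(x , y) , h} {(x′ , y′) , h′} eq with ,-injectiveʳ eq
  ... | refl = cong (_, h) (cong₂ _,_ (translate-injective h (,-injectiveˡ (,-injectiveˡ eq)))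
                                      (translate-injective h (,-injectiveʳ (,-injectiveˡ eq))))
  uV²×B : Unique (cartesianProduct V² B)
  uV²×B = Unique.cartesianProduct⁺ (Unique.cartesianProduct⁺ (vecs⁺ s uB) (vecs⁺ s uB)) uB
  τ-maps : ∀ {a} → a ∈ cartesianProduct V² B → P (proj₁ a) ≡ true →
           τ a ∈ cartesianProduct W² B × Q (τ a) ≡ true
  τ-maps {(x , y) , h} a∈ Pxy with ∈-cartesianProduct⁻ V² B a∈
  ... | xy∈V² , h∈B with ∈-cartesianProduct⁻ (vecs s B) (vecs s B) xy∈V²
  ... | x∈V , y∈V =
    ∈-cartesianProduct⁺ (∈-cartesianProduct⁺ (translate-∈-vecs h (λ u∈B → closed u∈B h∈B) x∈V)
                                             (translate-∈-vecs h (λ u∈B → closed u∈B h∈B) y∈V)) h∈B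
    , preserves h Pxy

ι : ℤ → ℚ
ι n = n ℚ./ 1

ι≡mkℚ : ∀ n → ι n ≡ mkℚ n 0 (Coprimality.sym (1-coprimeTo ℤ.∣ n ∣))
ι≡mkℚ n = ℚP.↥p/↧p≡p (mkℚ n 0 (Coprimality.sym (1-coprimeTo ℤ.∣ n ∣)))

ι-+ : ∀ a b → ι (a + b) ≡ ι a ℚ.+ ι b
ι-+ a b rewrite ι≡mkℚ a | ι≡mkℚ b = cong ι (cong₂ _+_ (sym (ℤP.*-identityʳ a)) (sym (ℤP.*-identityʳ b)))

ι-* : ∀ a b → ι (a * b) ≡ ι a ℚ.* ι b
ι-* a b rewrite ι≡mkℚ a | ι≡mkℚ b = refl

ι-neg : ∀ n → ι (ℤ.- n) ≡ ℚ.- ι n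
ι-neg n rewrite ι≡mkℚ n | ι≡mkℚ (ℤ.- n) with n
... | -[1+ _ ]  = refl
... | + zero    = refl
... | + (suc _) = refl

ι≤⇒ : ∀ {n Y} → ι n ≤ Y → n * ↧ Y ℤ.≤ ↥ Y
ι≤⇒ {n} {Y} le =
  subst (n * ↧ Y ℤ.≤_) (ℤP.*-identityʳ (↥ Y)) (ℚP.drop-*≤* (subst (_≤ Y) (ι≡mkℚ n) le))

ι≤⇐ : ∀ {n Y} → n * ↧ Y ℤ.≤ ↥ Y → ι n ≤ Y
ι≤⇐ {n} {Y} le =
  subst (_≤ Y) (sym (ι≡mkℚ n)) (*≤* (subst (n * ↧ Y ℤ.≤_) (sym (ℤP.*-identityʳ (↥ Y))) le))

≤ι⇐ : ∀ {n Y} → ↥ Y ℤ.≤ n * ↧ Y → Y ≤ ι n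
≤ι⇐ {n} {Y} le =
  subst (Y ≤_) (sym (ι≡mkℚ n)) (*≤* (subst (ℤ._≤ n * ↧ Y) (sym (ℤP.*-identityʳ (↥ Y))) le))

ι-mono-≤ : ∀ {a b} → a ℤ.≤ b → ι a ≤ ι b
ι-mono-≤ {a} {b} a≤b rewrite ι≡mkℚ a | ι≡mkℚ b = *≤* (ℤP.*-monoʳ-≤-nonNeg (+ 1) a≤b)

floor≡↥/ℕ↧ : ∀ Y → ℚ.floor Y ≡ ↥ Y ℤ./ℕ ↧ₙ Y
floor≡↥/ℕ↧ (mkℚ p d _) = ℤP.*-identityˡ (p ℤ./ℕ suc d)

floor*↧≤↥ : ∀ Y → ℚ.floor Y * ↧ Y ℤ.≤ ↥ Y
floor*↧≤↥ Y =
  subst (λ f → f * ↧ Y ℤ.≤ ↥ Y) (sym (floor≡↥/ℕ↧ Y)) ([n/ℕd]*d≤n (↥ Y) (↧ₙ Y))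

↥<suc[floor]*↧ : ∀ Y → ↥ Y ℤ.< ℤ.suc (ℚ.floor Y) * ↧ Y
↥<suc[floor]*↧ Y =
  subst (λ f → ↥ Y ℤ.< ℤ.suc f * ↧ Y) (sym (floor≡↥/ℕ↧ Y)) (n<s[n/ℕd]*d (↥ Y) (↧ₙ Y))

ι-floor≤ : ∀ Y → ι (ℚ.floor Y) ≤ Y
ι-floor≤ Y = ι≤⇐ {ℚ.floor Y} (floor*↧≤↥ Y)

≤ι-suc-floor : ∀ Y → Y ≤ ι (ℤ.suc (ℚ.floor Y))
≤ι-suc-floor Y = ≤ι⇐ {ℤ.suc (ℚ.floor Y)} (ℤP.<⇒≤ (↥<suc[floor]*↧ Y))

≤floor : ∀ n {Y} → ι n ≤ Y → n ℤ.≤ ℚ.floor Y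
≤floor n {Y} n≤Y = subst (n ℤ.≤_) (ℤP.pred-suc (ℚ.floor Y))
  (ℤP.i<j⇒i≤pred[j] (ℤP.*-cancelʳ-<-nonNeg {j = ℤ.suc (ℚ.floor Y)} (↧ Y)
    (ℤP.≤-<-trans (ι≤⇒ {n} n≤Y) (↥<suc[floor]*↧ Y))))

ι-neg-flip : ∀ n {Y} → ℚ.- Y ≤ ι n → ι (ℤ.- n) ≤ Y
ι-neg-flip n {Y} -Y≤n = subst₂ _≤_ (sym (ι-neg n)) (neg-involutive Y) (ℚP.neg-antimono-≤ -Y≤n)

i≤+suc∣i∣ : ∀ i → i ℤ.≤ + suc ℤ.∣ i ∣
i≤+suc∣i∣ (+ n)    = +≤+ (ℕP.n≤1+n n)
i≤+suc∣i∣ -[1+ n ] = ℤ.-≤+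

∈-rangeℤ : ∀ {B n} → ℤ.- + B ℤ.≤ n → n ℤ.≤ + B → n ∈ rangeℤ B
∈-rangeℤ {B} {n} -B≤n n≤B =
  subst (_∈ rangeℤ B) shift-back (∈-map⁺ (λ i → + i - + B) (∈-upTo⁺ (s≤s ∣n+B∣≤2B)))
  where
  +∣n+B∣≡n+B : + ℤ.∣ n + + B ∣ ≡ n + + B
  +∣n+B∣≡n+B =
    ℤP.0≤i⇒+∣i∣≡i (subst (ℤ._≤ n + + B) (ℤP.+-inverseˡ (+ B)) (ℤP.+-monoˡ-≤ (+ B) -B≤n))
  B+B≡2B : + B + + B ≡ + (2 ℕ.* B)
  B+B≡2B = cong (λ m → + (B ℕ.+ m)) (sym (ℕP.+-identityʳ B))
  ∣n+B∣≤2B : ℤ.∣ n + + B ∣ ℕ.≤ 2 ℕ.* B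
  ∣n+B∣≤2B = ℤP.drop‿+≤+ (subst₂ ℤ._≤_ (sym +∣n+B∣≡n+B) B+B≡2B (ℤP.+-monoˡ-≤ (+ B) n≤B))
  shift-back : + ℤ.∣ n + + B ∣ - + B ≡ n
  shift-back = trans (cong (_- + B) +∣n+B∣≡n+B) (cancel n (+ B))
    where
    cancel : ∀ a b → a + b - b ≡ a
    cancel = solve-∀

inBox? : ∀ Y n → Dec (ℚ.- Y ≤ ι n × ι n ≤ Y)
inBox? Y n = ℚ.- Y ℚ.≤? ι n ×-dec ι n ℚ.≤? Y

∈-box⁻ : ∀ {Y n} → n ∈ box Y → ℚ.- Y ≤ ι n × ι n ≤ Y
∈-box⁻ {Y} n∈ = proj₂ (∈-filter⁻ (inBox? Y) {xs = rangeℤ (suc ℤ.∣ ℚ.floor Y ∣)} n∈)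

∈-box⁺ : ∀ {Y} n → ℚ.- Y ≤ ι n → ι n ≤ Y → n ∈ box Y
∈-box⁺ {Y} n -Y≤n n≤Y = ∈-filter⁺ (inBox? Y) (∈-rangeℤ -B≤n n≤B) (-Y≤n , n≤Y)
  where
  B = suc ℤ.∣ ℚ.floor Y ∣
  n≤B : n ℤ.≤ + B
  n≤B = ℤP.≤-trans (≤floor n n≤Y) (i≤+suc∣i∣ (ℚ.floor Y))
  -B≤n : ℤ.- + B ℤ.≤ n
  -B≤n = subst (ℤ.- + B ℤ.≤_) (ℤP.neg-involutive n)
    (ℤP.neg-mono-≤ (ℤP.≤-trans (≤floor (ℤ.- n) (ι-neg-flip n -Y≤n)) (i≤+suc∣i∣ (ℚ.floor Y))))

box-unique : ∀ Y → Unique (box Y)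
box-unique Y = Unique.filter⁺ (inBox? Y) (Unique.map⁺ shift-injective (Unique.upTo⁺ _))
  where
  shift-injective : ∀ {i j} → + i - + suc ℤ.∣ ℚ.floor Y ∣ ≡ + j - + suc ℤ.∣ ℚ.floor Y ∣ → i ≡ j
  shift-injective eq = ℤP.+-injective (+-cancelʳ (ℤ.- + suc ℤ.∣ ℚ.floor Y ∣) (+ _) (+ _) eq)

2X≡X+X : ∀ X → (+ 2 ℚ./ 1) ℚ.* X ≡ X ℚ.+ X
2X≡X+X X = trans (ℚP.*-distribʳ-+ X ℚ.1ℚ ℚ.1ℚ) (cong₂ ℚ._+_ (ℚP.*-identityˡ X) (ℚP.*-identityˡ X))

box-+ : ∀ {X x h} → x ∈ box X → h ∈ box X → x + h ∈ box ((+ 2 ℚ./ 1) ℚ.* X)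
box-+ {X} {x} {h} x∈ h∈ with ∈-box⁻ {X} x∈ | ∈-box⁻ {X} h∈
... | -X≤x , x≤X | -X≤h , h≤X = ∈-box⁺ (x + h) lower upper
  where
  upper : ι (x + h) ≤ (+ 2 ℚ./ 1) ℚ.* X
  upper = subst₂ _≤_ (sym (ι-+ x h)) (sym (2X≡X+X X)) (ℚP.+-mono-≤ x≤X h≤X)
  lower : ℚ.- ((+ 2 ℚ./ 1) ℚ.* X) ≤ ι (x + h)
  lower = subst₂ _≤_ (trans (sym (ℚP.neg-distrib-+ X X)) (cong ℚ.-_ (sym (2X≡X+X X)))) (sym (ι-+ x h))
            (ℚP.+-mono-≤ -X≤x -X≤h)

≤length-box : ∀ {X} → ℚ.1ℚ ≤ X → X ≤ ι (+ length (box X))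
≤length-box {X} 1≤X = ℚP.≤-trans (≤ι-suc-floor X)
  (ι-mono-≤ (subst (ℤ._≤ + length (box X)) (cong ℤ.suc +m≡⌊X⌋) (+≤+ m+1≤length)))
  where
  m = ℤ.∣ ℚ.floor X ∣
  +m≡⌊X⌋ : + m ≡ ℚ.floor X
  +m≡⌊X⌋ = ℤP.0≤i⇒+∣i∣≡i (ℤP.≤-trans (+≤+ z≤n) (≤floor (+ 1) 1≤X))
  -X≤0 : ℚ.- X ≤ ℚ.0ℚ
  -X≤0 = ℚP.neg-antimono-≤ (ℚP.≤-trans (ι-mono-≤ {+ 0} {+ 1} (+≤+ z≤n)) 1≤X)
  upTo-m⊆box : map +_ (upTo (suc m)) ⊆ box X
  upTo-m⊆box z∈ with ∈-map⁻ +_ z∈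
  ... | i , i∈ , refl = ∈-box⁺ (+ i) (ℚP.≤-trans -X≤0 (ι-mono-≤ {+ 0} {+ i} (+≤+ z≤n)))
    (ℚP.≤-trans (ι-mono-≤ {+ i} (subst (+ i ℤ.≤_) +m≡⌊X⌋ (+≤+ (ℕP.≤-pred (∈-upTo⁻ i∈)))))
                (ι-floor≤ X))
  m+1≤length : suc m ℕ.≤ length (box X)
  m+1≤length = subst (ℕ._≤ length (box X)) (trans (LP.length-map +_ (upTo (suc m))) (LP.length-upTo (suc m)))
    (Unique-⊆⇒length≤ (Unique.map⁺ ℤP.+-injective (Unique.upTo⁺ (suc m))) upTo-m⊆box)

J*∣box∣≤H : ∀ s k X (a : Vec ℤ k) → J s k X a ℕ.* length (box X) ℕ.≤ H s k X a
J*∣box∣≤H s k X a = begin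
  J s k X a ℕ.* length B
    ≡⟨ cong (λ l → count P l ℕ.* length B) (concatMap≡× V V) ⟩
  count P (cartesianProduct V V) ℕ.* length B
    ≤⟨ translation-count s (box-unique X) (box-+ {X}) (translate-solution a) ⟩
  count Q (cartesianProduct (cartesianProduct W W) B)
    ≡⟨ cong (count Q) (trans (cong (λ l → concatMap (λ zw → map (zw ,_) B) l) (concatMap≡× W W))
                             (concatMap≡× (cartesianProduct W W) B)) ⟨
  H s k X a ∎
  where
  open ℕP.≤-Reasoning
  B = box X
  V = vecs s B
  W = vecs s (box ((+ 2 ℚ./ 1) ℚ.* X))
  P : Vec ℤ s × Vec ℤ s → Bool
  P (x , y) = allEq k x y (coeff a)
  Q : (Vec ℤ s × Vec ℤ s) × ℤ → Bool
  Q ((z , w) , h) = allEq k z w (λ j → pPoly a j h)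
  concatMap≡× : ∀ {A B : Set} (xs : List A) (ys : List B) →
                concatMap (λ x → map (x ,_) ys) xs ≡ cartesianProduct xs ys
  concatMap≡× = concatMap-map≡cartesianProductWith _,_

lemma2p1 : (s k : ℕ) → 1 ℕ.≤ s → 1 ℕ.≤ k →
    Σ ℕ λ C → (a : Vec ℤ k) (X : ℚ) → ℚ.1ℚ ℚ.≤ X →
      X ℚ.* (+ J s k X a ℚ./ 1) ℚ.≤ (+ C ℚ./ 1) ℚ.* (+ H s k X a ℚ./ 1)
-- The bound holds for all s and k.
lemma2p1 s k _ _ = 1 , λ a X 1≤X →
  let L = length (box X) ; Jₐ = J s k X a ; Hₐ = H s k X a in begin
  X ℚ.* ι (+ Jₐ)
    ≤⟨ ℚP.*-monoʳ-≤-nonNeg (ι (+ Jₐ)) {{ℚP.normalize-nonNeg Jₐ 1}} (≤length-box 1≤X) ⟩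
  ι (+ L) ℚ.* ι (+ Jₐ)
    ≡⟨ ι-* (+ L) (+ Jₐ) ⟨
  ι (+ L * + Jₐ)
    ≡⟨ cong ι (ℤP.pos-* L Jₐ) ⟨
  ι (+ (L ℕ.* Jₐ))
    ≤⟨ ι-mono-≤ (+≤+ (subst (ℕ._≤ Hₐ) (ℕP.*-comm Jₐ L) (J*∣box∣≤H s k X a))) ⟩
  ι (+ Hₐ)
    ≡⟨ ℚP.*-identityˡ (ι (+ Hₐ)) ⟨
  ℚ.1ℚ ℚ.* ι (+ Hₐ) ∎
  where open ℚP.≤-Reasoning
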